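{- Let $n\ge 3$ and let $L=\mathbf{2}^n$ be a Boolean lattice (equivalently, a blow-up $L^B$ of $\mathbf{2}^n$ in which every chain is a single element, so $L^B\cong L$). Then $G^c(L)_{SR}=G(L)$.
   Context: For a lattice $M$ with $0$: $Z^*(M)$ is the set of nonzero $a$ with $a\wedge b=0$ for some $b\neq0$; the zero-divisor graph $G(M)$ has vertex set $Z^*(M)$ with distinct $a,b$ adjacent iff $a\wedge b=0$, and $G^c(M)$ is its complement (same vertices, adjacent iff $a\wedge b\neq0$). Blow-up of $\mathbf{2}^n$: replace each $a\in\mathbf{2}^n\setminus\{0,1\}$ by a finite nonempty chain $C_a$, with $x\le y$ iff $x=0$, or $y=1$, or $x,y$ in the same chain with $x\le y$, or $x\in C_a,y\in C_b$ with $a<b$. In a connected graph $G$, $u$ is maximally distant from $v$ if $d(v,w)\le d(u,v)$ for every neighbor $w$ of $u$; $u,v$ are mutually maximally distant if each is maximally distant from the other; $\partial(G)$ is the set of vertices mutually maximally distant from some vertex; the strong resolving graph $G_{SR}$ has vertex set $\partial(G)$ with distinct $u,v$ adjacent iff mutually maximally distant in $G$. -}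

module Defs where

open import Data.Nat using (ℕ; zero; suc; _≤_)
open import Data.Product using (Σ; ∃; _×_)
open import Relation.Nullary using (¬_)
open import Relation.Binary.PropositionalEquality using (_≡_; _≢_)
open import Data.Fin.Subset using (Subset; _∩_; ⊥)

module GraphNotions {A : Set} (V : A → Set) (E : A → A → Set) where

  data Walk : A → A → ℕ → Set where
    here : ∀ {u} → Walk u u 0
    step : ∀ {u w v k} → V w → E u w → Walk w v k → Walk u v (suc k)

  Dist : A → A → ℕ → Set
  Dist u v k = Walk u v k × (∀ j → Walk u v j → k ≤ j)

  MaxDistFrom : A → A → Set
  MaxDistFrom u v = ∀ w → V w → E u w → ∀ j k → Dist v w j → Dist u v k → j ≤ k

  MutuallyMaxDist : A → A → Set
  MutuallyMaxDist u v = MaxDistFrom u v × MaxDistFrom v u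

  Boundary : A → Set
  Boundary u = V u × Σ A (λ v → V v × MutuallyMaxDist u v)

  SRVertex : A → Set
  SRVertex = Boundary

  SRAdj : A → A → Set
  SRAdj u v = u ≢ v × MutuallyMaxDist u v

module ZeroDivisor {A : Set} (_∧_ : A → A → A) (𝟘 : A) where

  Zstar : A → Set
  Zstar a = a ≢ 𝟘 × Σ A (λ b → b ≢ 𝟘 × (a ∧ b) ≡ 𝟘)

  GAdj : A → A → Set
  GAdj a b = a ≢ b × (a ∧ b) ≡ 𝟘

  GcAdj : A → A → Set
  GcAdj a b = a ≢ b × ¬ ((a ∧ b) ≡ 𝟘)

-- The Boolean lattice 2^n, realised as subsets of Fin n (meet = ∩, 0 = ∅)

module BoolLat (n : ℕ) = ZeroDivisor {Subset n} _∩_ ⊥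

module GcSR (n : ℕ) = GraphNotions (BoolLat.Zstar n) (BoolLat.GcAdj n)

-- For n ≥ 3 any two zero-divisors of 2ⁿ are joined in Gᶜ by a path of length
-- at most two (disjoint a ∋ x and b ∋ y through the zero-divisor {x, y}), so
-- Gᶜ has diameter two and distance two is exactly disjointness.  Disjoint
-- zero-divisors are therefore mutually maximally distant.  Conversely, if u
-- and v meet and x ∈ u ∖ v, then {x} is a neighbour of u at distance two from
-- v, so u is not maximally distant from v.
{-# OPTIONS --safe #-}
module Submission where

open import Defs
open import Data.Bool using () renaming (_≟_ to _≟ᵇ_)
open import Data.Empty using (⊥-elim)
open import Data.Fin using (Fin; zero; suc)
open import Data.Fin.Subset using (Subset; _∩_; _∪_; ⊥; ⁅_⁆; _∈_; _∉_; _⊆_; ∁; Nonempty)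
open import Data.Fin.Subset.Properties
open import Data.Nat using (ℕ; zero; suc; _≤_; z≤n; s≤s)
open import Data.Nat.Properties using (≤-refl; ≤-trans; 1+n≰n)
open import Data.Product using (_×_; _,_; proj₁; ∃; uncurry)
open import Data.Sum using (_⊎_; inj₁; inj₂; [_,_])
open import Data.Vec.Properties using (≡-dec)
open import Function using (_∘_)
open import Function.Bundles using (_⇔_; mk⇔)
open import Relation.Binary.Definitions using (DecidableEquality)
open import Relation.Binary.PropositionalEquality using (_≡_; _≢_; refl; sym; trans; subst)
open import Relation.Nullary using (¬_; yes; no)
open import Relation.Nullary.Decidable using (decidable-stable)

module DiameterTwo {A : Set} (V : A → Set) (E : A → A → Set) where
  open GraphNotions V E

  private variable
    u v w : A
    k : ℕ

  Diameter≤2 : Set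
  Diameter≤2 = ∀ {a b} → V a → V b → ∃ λ j → j ≤ 2 × Walk a b j

  nonadjacent⇒2≤length : u ≢ v → ¬ E u v → Walk u v k → 2 ≤ k
  nonadjacent⇒2≤length u≢v _   here                     = ⊥-elim (u≢v refl)
  nonadjacent⇒2≤length _   ¬uv (step _ uv here)         = ⊥-elim (¬uv uv)
  nonadjacent⇒2≤length _   _   (step _ _ (step _ _ _)) = s≤s (s≤s z≤n)

  adjacent⇒Dist1 : u ≢ v → V v → E u v → Dist u v 1
  adjacent⇒Dist1 u≢v Vv uv = step Vv uv here , λ where
    zero    here → ⊥-elim (u≢v refl)
    (suc _) _    → s≤s z≤n

  nonadjacent⇒Dist2 : u ≢ v → ¬ E u v → Walk u v 2 → Dist u v 2
  nonadjacent⇒Dist2 u≢v ¬uv walk = walk , λ _ → nonadjacent⇒2≤length u≢v ¬uv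

  nonadjacent⇒MaxDistFrom : Diameter≤2 → V v → u ≢ v → ¬ E u v → MaxDistFrom u v
  nonadjacent⇒MaxDistFrom diam Vv u≢v ¬uv w Vw _ j k (_ , j-minimal) (walk-uv , _) =
    let (j′ , j′≤2 , walk-vw) = diam Vv Vw
    in ≤-trans (j-minimal j′ walk-vw) (≤-trans j′≤2 (nonadjacent⇒2≤length u≢v ¬uv walk-uv))

  farther-neighbour⇒¬MaxDistFrom : Dist u v 1 → V w → E u w → Dist v w 2 → ¬ MaxDistFrom u v
  farther-neighbour⇒¬MaxDistFrom dist-uv Vw uw dist-vw u-max = 1+n≰n (u-max _ Vw uw 2 1 dist-vw dist-uv)

private variable
  n : ℕ
  p q : Subset n
  x y : Fin n

avoid-two : 3 ≤ n → (x y : Fin n) → ∃ λ z → z ≢ x × z ≢ y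
avoid-two (s≤s (s≤s (s≤s _))) = λ where
  zero          zero          → suc zero , (λ ()) , (λ ())
  zero          (suc zero)    → suc (suc zero) , (λ ()) , (λ ())
  zero          (suc (suc _)) → suc zero , (λ ()) , (λ ())
  (suc zero)    zero          → suc (suc zero) , (λ ()) , (λ ())
  (suc (suc _)) zero          → suc zero , (λ ()) , (λ ())
  (suc _)       (suc _)       → zero , (λ ()) , (λ ())

_≟ₛ_ : DecidableEquality (Subset n)
_≟ₛ_ = ≡-dec _≟ᵇ_

∈⇒≢⊥ : x ∈ p → p ≢ ⊥
∈⇒≢⊥ {x = x} x∈p p≡⊥ = ∉⊥ (subst (x ∈_) p≡⊥ x∈p)

≢⊥⇒Nonempty : p ≢ ⊥ → Nonempty p
≢⊥⇒Nonempty {p = p} p≢⊥ = decidable-stable (nonempty? p) (p≢⊥ ∘ Empty-unique)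

common⇒¬disjoint : x ∈ p → x ∈ q → p ∩ q ≢ ⊥
common⇒¬disjoint x∈p x∈q = ∈⇒≢⊥ (x∈p∩q⁺ (x∈p , x∈q))

disjoint⇒∉ : p ∩ q ≡ ⊥ → x ∈ p → x ∉ q
disjoint⇒∉ p∩q≡⊥ x∈p x∈q = common⇒¬disjoint x∈p x∈q p∩q≡⊥

∉⇒disjoint : (∀ {x} → x ∈ p → x ∉ q) → p ∩ q ≡ ⊥
∉⇒disjoint {p = p} {q} p∉q = Empty-unique λ (_ , x∈p∩q) → uncurry p∉q (x∈p∩q⁻ p q x∈p∩q)

disjoint-sym : p ∩ q ≡ ⊥ → q ∩ p ≡ ⊥
disjoint-sym {p = p} {q} = trans (∩-comm q p)

≢⊥∧disjoint⇒≢ : p ≢ ⊥ → p ∩ q ≡ ⊥ → p ≢ q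
≢⊥∧disjoint⇒≢ {p = p} p≢⊥ p∩p≡⊥ refl = p≢⊥ (trans (sym (∩-idem p)) p∩p≡⊥)

⊈⇒∃∉ : ¬ p ⊆ q → ∃ λ x → x ∈ p × x ∉ q
⊈⇒∃∉ {p = p} {q} p⊈q with nonempty? (p ∩ ∁ q)
... | yes (x , x∈p∩∁q) = let (x∈p , x∈∁q) = x∈p∩q⁻ p (∁ q) x∈p∩∁q in x , x∈p , x∈∁p⇒x∉p x∈∁q
... | no p∩∁q-empty = ⊥-elim (p⊈q λ {x} x∈p → decidable-stable (x ∈? q) λ x∉q →
        p∩∁q-empty (x , x∈p∩q⁺ (x∈p , x∉p⇒x∈∁p x∉q)))

≢⇒∃∈∉ : p ≢ q → (∃ λ x → x ∈ p × x ∉ q) ⊎ (∃ λ x → x ∈ q × x ∉ p)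
≢⇒∃∈∉ {p = p} {q} p≢q with p ⊆? q | q ⊆? p
... | no p⊈q  | _        = inj₁ (⊈⇒∃∉ p⊈q)
... | yes _   | no q⊈p   = inj₂ (⊈⇒∃∉ q⊈p)
... | yes p⊆q | yes q⊆p = ⊥-elim (p≢q (⊆-antisym p⊆q q⊆p))

module _ {n : ℕ} where
  open BoolLat n

  ∈∧∉⇒Zstar : x ∈ p → y ∉ p → Zstar p
  ∈∧∉⇒Zstar {y = y} x∈p y∉p = ∈⇒≢⊥ x∈p , ⁅ y ⁆ , ∈⇒≢⊥ (x∈⁅x⁆ y) ,
    ∉⇒disjoint λ z∈p z∈⁅y⁆ → y∉p (subst (_∈ _) (x∈⁅y⁆⇒x≡y y z∈⁅y⁆) z∈p)

  disjoint⇒Zstar : p ≢ ⊥ → q ≢ ⊥ → p ∩ q ≡ ⊥ → Zstar p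
  disjoint⇒Zstar {q = q} p≢⊥ q≢⊥ p∩q≡⊥ = p≢⊥ , q , q≢⊥ , p∩q≡⊥

  disjoint⇒¬GcAdj : p ∩ q ≡ ⊥ → ¬ GcAdj p q
  disjoint⇒¬GcAdj p∩q≡⊥ (_ , p∩q≢⊥) = p∩q≢⊥ p∩q≡⊥

module BooleanLatticeGc {n : ℕ} (3≤n : 3 ≤ n) where
  open BoolLat n
  open GcSR n
  open DiameterTwo Zstar GcAdj

  private variable
    a b u v : Subset n

  Zstar-singleton : (x : Fin n) → Zstar ⁅ x ⁆
  Zstar-singleton x =
    let (z , z≢x , _) = avoid-two 3≤n x x
    in ∈∧∉⇒Zstar (x∈⁅x⁆ x) (x≢y⇒x∉⁅y⁆ z≢x)

  Zstar-pair : (x y : Fin n) → Zstar (⁅ x ⁆ ∪ ⁅ y ⁆)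
  Zstar-pair x y =
    let (z , z≢x , z≢y) = avoid-two 3≤n x y
    in ∈∧∉⇒Zstar (x∈p∪q⁺ (inj₁ (x∈⁅x⁆ x))) ([ x≢y⇒x∉⁅y⁆ z≢x , x≢y⇒x∉⁅y⁆ z≢y ] ∘ x∈p∪q⁻ _ _)

  disjoint⇒Walk2 : Zstar a → Zstar b → a ∩ b ≡ ⊥ → Walk a b 2
  disjoint⇒Walk2 {a} {b} Za Zb a∩b≡⊥ with ≢⊥⇒Nonempty (proj₁ Za) | ≢⊥⇒Nonempty (proj₁ Zb)
  ... | x , x∈a | y , y∈b =
    step (Zstar-pair x y) (a≢m , common⇒¬disjoint x∈a x∈m) (step Zb (m≢b , common⇒¬disjoint y∈m y∈b) here)
    where
    m : Subset n
    m = ⁅ x ⁆ ∪ ⁅ y ⁆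
    x∈m : x ∈ m
    x∈m = x∈p∪q⁺ (inj₁ (x∈⁅x⁆ x))
    y∈m : y ∈ m
    y∈m = x∈p∪q⁺ (inj₂ (x∈⁅x⁆ y))
    a≢m : a ≢ m
    a≢m a≡m = disjoint⇒∉ a∩b≡⊥ (subst (y ∈_) (sym a≡m) y∈m) y∈b
    m≢b : m ≢ b
    m≢b m≡b = disjoint⇒∉ a∩b≡⊥ x∈a (subst (x ∈_) m≡b x∈m)

  Gc-diameter≤2 : Diameter≤2
  Gc-diameter≤2 {a} {b} Za Zb with (a ∩ b) ≟ₛ ⊥
  ... | yes a∩b≡⊥ = 2 , ≤-refl , disjoint⇒Walk2 Za Zb a∩b≡⊥
  ... | no a∩b≢⊥ with a ≟ₛ b
  ...   | yes refl = 0 , z≤n , here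
  ...   | no a≢b   = 1 , s≤s z≤n , step Zb (a≢b , a∩b≢⊥) here

  disjoint⇒MaxDistFrom : Zstar a → Zstar b → a ∩ b ≡ ⊥ → MaxDistFrom a b
  disjoint⇒MaxDistFrom Za Zb a∩b≡⊥ =
    nonadjacent⇒MaxDistFrom Gc-diameter≤2 Zb (≢⊥∧disjoint⇒≢ (proj₁ Za) a∩b≡⊥) (disjoint⇒¬GcAdj a∩b≡⊥)

  disjoint⇒MutuallyMaxDist : Zstar u → Zstar v → u ∩ v ≡ ⊥ → MutuallyMaxDist u v
  disjoint⇒MutuallyMaxDist Zu Zv u∩v≡⊥ =
    disjoint⇒MaxDistFrom Zu Zv u∩v≡⊥ , disjoint⇒MaxDistFrom Zv Zu (disjoint-sym u∩v≡⊥)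

  meeting∧∈∉⇒¬MaxDistFrom : Zstar v → u ≢ v → u ∩ v ≢ ⊥ → x ∈ u → x ∉ v → ¬ MaxDistFrom u v
  meeting∧∈∉⇒¬MaxDistFrom {v} {u} {x} Zv u≢v u∩v≢⊥ x∈u x∉v =
    farther-neighbour⇒¬MaxDistFrom
      (adjacent⇒Dist1 u≢v Zv (u≢v , u∩v≢⊥))
      (Zstar-singleton x)
      (u≢⁅x⁆ , common⇒¬disjoint x∈u (x∈⁅x⁆ x))
      (nonadjacent⇒Dist2 (≢⊥∧disjoint⇒≢ (proj₁ Zv) v∩⁅x⁆≡⊥) (disjoint⇒¬GcAdj v∩⁅x⁆≡⊥)
        (disjoint⇒Walk2 Zv (Zstar-singleton x) v∩⁅x⁆≡⊥))
    where
    v∩⁅x⁆≡⊥ : v ∩ ⁅ x ⁆ ≡ ⊥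
    v∩⁅x⁆≡⊥ = ∉⇒disjoint λ y∈v y∈⁅x⁆ → x∉v (subst (_∈ v) (x∈⁅y⁆⇒x≡y x y∈⁅x⁆) y∈v)
    u≢⁅x⁆ : u ≢ ⁅ x ⁆
    u≢⁅x⁆ refl = u∩v≢⊥ (disjoint-sym v∩⁅x⁆≡⊥)

  MutuallyMaxDist⇒disjoint : Zstar u → Zstar v → u ≢ v → MutuallyMaxDist u v → u ∩ v ≡ ⊥
  MutuallyMaxDist⇒disjoint {u} {v} Zu Zv u≢v (u-max , v-max) =
    decidable-stable ((u ∩ v) ≟ₛ ⊥) λ u∩v≢⊥ → [
      (λ (_ , x∈u , x∉v) → meeting∧∈∉⇒¬MaxDistFrom Zv u≢v u∩v≢⊥ x∈u x∉v u-max) ,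
      (λ (_ , x∈v , x∉u) →
        meeting∧∈∉⇒¬MaxDistFrom Zu (u≢v ∘ sym) (u∩v≢⊥ ∘ disjoint-sym) x∈v x∉u v-max)
      ] (≢⇒∃∈∉ u≢v)

  Zstar⇒Boundary : Zstar u → Boundary u
  Zstar⇒Boundary Zu@(u≢⊥ , b , b≢⊥ , u∩b≡⊥) = Zu , b , Zb , disjoint⇒MutuallyMaxDist Zu Zb u∩b≡⊥
    where
    Zb : Zstar b
    Zb = disjoint⇒Zstar b≢⊥ u≢⊥ (disjoint-sym u∩b≡⊥)

corollary3p17 : (n : ℕ) → 3 ≤ n →
    ((u : Subset n) → GcSR.SRVertex n u ⇔ BoolLat.Zstar n u)
    × ((u v : Subset n) → GcSR.SRVertex n u → GcSR.SRVertex n v →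
         (GcSR.SRAdj n u v ⇔ BoolLat.GAdj n u v))
corollary3p17 n 3≤n =
  (λ _ → mk⇔ proj₁ Zstar⇒Boundary) ,
  λ _ _ (Zu , _) (Zv , _) → mk⇔
    (λ (u≢v , mutually-max) → u≢v , MutuallyMaxDist⇒disjoint Zu Zv u≢v mutually-max)
    (λ (u≢v , u∩v≡⊥) → u≢v , disjoint⇒MutuallyMaxDist Zu Zv u∩v≡⊥)
  where open BooleanLatticeGc 3≤n
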